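{- Let $a\in\mathbb C\setminus\{0\}$ and $b\in\mathbb C$. Then $\{\mathrm{comm}(\widehat{\mathcal B}(a,b)_\lambda):\lambda\text{ a partition}\}$ is a multiplicative basis of $\mathsf{Sym}$, i.e. it is a basis and $\mathrm{comm}(\widehat{\mathcal B}(a,b)_\lambda)\,\mathrm{comm}(\widehat{\mathcal B}(a,b)_\mu)=\mathrm{comm}(\widehat{\mathcal B}(a,b)_{\lambda\cdot\mu})$ for all partitions $\lambda,\mu$.
   Context: $[n-1]=\{1,\dots,n-1\}$; compositions of $n$ correspond to subsets of $[n-1]$ via $\mathrm{set}$ (partial sums) and inverse $\mathrm{comp}$; $\alpha^c=\mathrm{comp}([n-1]\setminus\mathrm{set}(\alpha))$. Partitions are regarded as compositions with weakly decreasing parts; for partitions $\lambda,\mu$, $\lambda\cdot\mu$ denotes the partition whose parts are those of $\lambda$ and of $\mu$ together. $\mathsf{NSym}$: free associative $\mathbb C$-algebra on $H_1,H_2,\dots$, $H_\alpha=H_{\alpha_1}\cdots H_{\alpha_l}$. $\mathsf{Sym}$: symmetric functions over $\mathbb C$; $\mathrm{comm}:\mathsf{NSym}\to\mathsf{Sym}$ the algebra homomorphism $H_n\mapsto h_n$ (complete homogeneous). For $I\subseteq[n-1]$, $\mathcal B(a,b)_{\mathrm{comp}(I)}=\sum_{J\subseteq[n-1]:\,I\cup J=[n-1]}a^{|I\setminus J|}b^{|I\cap J|}H_{\mathrm{comp}(J)}$ ($0^0=1$) and $\widehat{\mathcal B}(a,b)_\alpha=\mathcal B(a,b)_{\alpha^c}$.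 -}

module Defs where

open import Level using (_⊔_)
open import Algebra.Bundles using (CommutativeRing)
open import Data.Nat as ℕ using (ℕ; zero; suc; _∸_; _≤_)
open import Data.Nat.ListAction using (sum)
open import Data.Nat.Properties as ℕP using (≤-decTotalOrder)
open import Data.Fin using (Fin; toℕ)
open import Data.Fin.Subset using (Subset; ∁; _∪_; _∩_; _─_; ∣_∣; ⊤)
open import Data.Vec as Vec using (Vec; []; _∷_; tabulate)
import Data.Vec.Properties as VecP
open import Data.List as List
  using (List; []; _∷_; [_]; _++_; map; filter; concatMap; reverse; foldr)
import Data.List.Properties as ListP
open import Data.List.Relation.Unary.All using (All)
open import Data.List.Relation.Unary.Any using (any?)
open import Data.List.Relation.Unary.Linked using (Linked)
open import Data.List.Relation.Unary.Unique.Propositional using (Unique)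
open import Data.Bool as Bool using (Bool; true; false)
open import Data.Product using (_×_; _,_; proj₁; proj₂; ∃)
open import Function using (_∘_)
open import Relation.Nullary using (¬_; does)
open import Relation.Binary.PropositionalEquality using (_≡_)
import Data.List.Sort.InsertionSort as InsSort

-- A composition of n is a list of positive naturals summing to n.
-- A subset of [n-1] = {1,…,n-1} is a 'Subset (n ∸ 1)' (Vec Bool),
-- where position i : Fin (n ∸ 1) stands for the element toℕ i + 1.

psums : List ℕ → List ℕ
psums = go 0
  where
  go : ℕ → List ℕ → List ℕ
  go s []       = []
  go s (x ∷ xs) = (s ℕ.+ x) ∷ go (s ℕ.+ x) xs

setC : (α : List ℕ) → Subset (sum α ∸ 1)
setC α = tabulate (λ i → does (any? (λ s → s ℕ.≟ suc (toℕ i)) (psums α)))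

-- comp : subsets of [n-1] → compositions of n (inverse of set)
compAux : ∀ {m} → ℕ → Vec Bool m → List ℕ
compAux r []            = r ∷ []
compAux r (true  ∷ v)   = r ∷ compAux 1 v
compAux r (false ∷ v)   = compAux (suc r) v

comp : (n : ℕ) → Subset (n ∸ 1) → List ℕ
comp zero    _ = []
comp (suc m) I = compAux 1 I

_ᶜ : List ℕ → List ℕ
α ᶜ = comp (sum α) (∁ (setC α))

subsets : (m : ℕ) → List (Subset m)
subsets zero    = [ [] ]
subsets (suc m) = map (true ∷_) (subsets m) ++ map (false ∷_) (subsets m)

IsPartition : List ℕ → Set
IsPartition λ′ = All (λ x → 1 ≤ x) λ′ × Linked (λ x y → y ≤ x) λ′

sortDesc : List ℕ → List ℕ
sortDesc = reverse ∘ InsSort.sort ≤-decTotalOrder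

_·P_ : List ℕ → List ℕ → List ℕ
λ′ ·P μ = sortDesc (λ′ ++ μ)

IsField : ∀ {c ℓ} → CommutativeRing c ℓ → Set (c ⊔ ℓ)
IsField R = (¬ (1# ≈ 0#)) × (∀ x → ¬ (x ≈ 0#) → ∃ λ y → x * y ≈ 1#)
  where open CommutativeRing R

module WithRing {c ℓ} (R : CommutativeRing c ℓ) where
  open CommutativeRing R

  pow : Carrier → ℕ → Carrier
  pow x zero    = 1#
  pow x (suc k) = x * pow x k

  -- An element of NSym given as a formal linear combination Σ cᵢ H_{αᵢ}
  -- (H_α = H_{α₁}⋯H_{αₗ}, a noncommutative monomial / word).
  NSym : Set c
  NSym = List (Carrier × List ℕ)

  -- An element of Sym = ℂ[h₁,h₂,…] given as a formal combination Σ cᵢ h_{κᵢ},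
  -- h_κ = h_{κ₁}⋯h_{κₗ} (commutative), with the convention h₀ = 1.
  Sym : Set c
  Sym = List (Carrier × List ℕ)

  -- the monomial h_κ equals h_{shape κ}, shape κ a partition
  shape : List ℕ → List ℕ
  shape κ = sortDesc (filter (λ x → ¬? (x ℕ.≟ 0)) κ)
    where open import Relation.Nullary using (¬?)

  coeff : Sym → List ℕ → Carrier
  coeff f λ′ = foldr _+_ 0#
    (map proj₁ (filter (λ t → ListP.≡-dec ℕ._≟_ (shape (proj₂ t)) λ′) f))

  infix 4 _≈S_
  _≈S_ : Sym → Sym → Set ℓ
  f ≈S g = ∀ λ′ → coeff f λ′ ≈ coeff g λ′

  0S : Sym
  0S = []

  infixl 7 _*S_
  _*S_ : Sym → Sym → Sym
  f *S g = concatMap (λ t → map (λ u → (proj₁ t * proj₁ u , proj₂ t ++ proj₂ u)) g) f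

  infixr 7 _·S_
  _·S_ : Carrier → Sym → Sym
  x ·S f = map (λ t → (x * proj₁ t , proj₂ t)) f

  lincomb : List (Carrier × List ℕ) → (List ℕ → Sym) → Sym
  lincomb cs v = concatMap (λ t → proj₁ t ·S v (proj₂ t)) cs

  -- comm : NSym → Sym,  H_α ↦ h_α = h_{α₁}⋯h_{αₗ}
  comm : NSym → Sym
  comm f = map (λ t → (proj₁ t , proj₂ t)) f

  Bsub : Carrier → Carrier → (n : ℕ) → Subset (n ∸ 1) → NSym
  Bsub a b n I =
    map (λ J → (pow a ∣ I ─ J ∣ * pow b ∣ I ∩ J ∣ , comp n J))
        (filter (λ J → VecP.≡-dec Bool._≟_ (I ∪ J) ⊤) (subsets (n ∸ 1)))

  𝓑 : Carrier → Carrier → List ℕ → NSym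
  𝓑 a b α = Bsub a b (sum α) (setC α)

  𝓑̂ : Carrier → Carrier → List ℕ → NSym
  𝓑̂ a b α = 𝓑 a b (α ᶜ)

  LinIndep : (List ℕ → Sym) → Set (c ⊔ ℓ)
  LinIndep v = ∀ (cs : List (Carrier × List ℕ))
    → All (IsPartition ∘ proj₂) cs
    → Unique (map proj₂ cs)
    → lincomb cs v ≈S 0S
    → All (λ t → proj₁ t ≈ 0#) cs

  Spans : (List ℕ → Sym) → Set (c ⊔ ℓ)
  Spans v = ∀ (f : Sym) → ∃ λ (cs : List (Carrier × List ℕ))
    → All (IsPartition ∘ proj₂) cs × (f ≈S lincomb cs v)

  IsBasis : (List ℕ → Sym) → Set (c ⊔ ℓ)
  IsBasis v = LinIndep v × Spans v

  Multiplicative : (List ℕ → Sym) → Set ℓ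
  Multiplicative v = ∀ λ′ μ → IsPartition λ′ → IsPartition μ
    → v λ′ *S v μ ≈S v (λ′ ·P μ)

-- Pair a formal combination Σ cᵢ H_{wᵢ} with a function ψ on words as Σ cᵢ ψ(wᵢ); the
-- coefficient of h_μ is the pairing with the indicator of the shape μ.  Summing over the
-- J ⊇ [n-1] ∖ I position by position shows 𝓑̂(a,b)_{α ++ β} = 𝓑̂(a,b)_α 𝓑̂(a,b)_β, since the
-- junction of α and β is always a cut; hence comm ∘ 𝓑̂(a,b) is multiplicative and does not see
-- the order of the parts.  Every word occurring in 𝓑̂(a,b)_λ refines λ, and λ itself occurs
-- once, with coefficient a^(|λ| - ℓ(λ)).  So comm(𝓑̂(a,b)_λ) is a^(|λ| - ℓ(λ)) h_λ plus terms
-- h_μ with |μ| = |λ| and ℓ(μ) > ℓ(λ); for invertible a this triangularity gives linear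
-- independence by induction on ℓ(λ) and spanning by induction on |λ| - ℓ(λ).

module Submission where

open import Defs
open import Algebra.Bundles using (CommutativeRing)
open import Data.Bool as Bool using (Bool; true; false; not; _∧_; if_then_else_)
open import Data.Bool.Properties using (∧-identityʳ; ∧-zeroʳ)
open import Data.Fin.Subset using (Subset; _∪_; _∩_; _─_; ∣_∣; ⊤)
open import Data.List as List using (List; []; _∷_; _++_; [_]; map; filter; replicate; length)
import Data.List.Properties as ListP
open import Data.List.Membership.Propositional using (_∈_)
import Data.List.Membership.Propositional.Properties as ∈P
open import Data.List.Relation.Binary.Permutation.Propositional as ↭ using (_↭_)
open import Data.List.Relation.Binary.Permutation.Propositional.Properties using (All-resp-↭; ++⁺ˡ; shifts)
open import Data.List.Relation.Unary.All as All using (All; []; _∷_)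
import Data.List.Relation.Unary.All.Properties as AllP
open import Data.List.Relation.Unary.AllPairs using (_∷_)
open import Data.List.Relation.Unary.Any using (here; there)
open import Data.List.Relation.Unary.Unique.Propositional using (Unique)
open import Data.Nat as ℕ using (ℕ; zero; suc; _∸_; _≤_; _<_; s≤s; z≤n)
import Data.Nat.Induction as ℕInd
open import Data.Nat.ListAction using (sum)
import Data.Nat.ListAction.Properties as ℕListP
import Data.Nat.Properties as ℕP
open import Data.Product using (_×_; _,_; proj₁; proj₂; ∃)
open import Data.Sum using ([_,_]′)
open import Data.Vec as Vec using (Vec; []; _∷_; toList)
import Data.Vec.Properties as VecP
open import Function using (_∘_)
import Induction.WellFounded as WF
open import Level using (_⊔_)
import Relation.Binary.Construct.On as On
open import Relation.Binary.Definitions using (DecidableEquality)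
open import Relation.Binary.PropositionalEquality as ≡ using (_≡_; _≢_)
open import Relation.Nullary using (¬_; Dec; does; yes; no)
open import Relation.Nullary.Decidable using (dec-true; dec-false)
open import Relation.Unary using (Decidable)

-- Compositions, subsets of [n-1] and partitions

module Combinatorics where

  open import Data.Fin using (toℕ)
  open import Data.Fin.Subset using (∁)
  open import Data.List.Relation.Binary.Permutation.Propositional using (↭-sym; ↭-trans; ↭⇒↭ₛ)
  open import Data.List.Relation.Binary.Permutation.Propositional.Properties
    using (↭-reverse; filter-↭; ↭-length)
  open import Data.List.Relation.Binary.Pointwise using (Pointwise-≡⇒≡)
  open import Data.List.Relation.Unary.AllPairs using (AllPairs; [])
  import Data.List.Relation.Unary.AllPairs.Properties as AllPairsP
  open import Data.List.Relation.Unary.Any using (any?)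
  open import Data.List.Relation.Unary.Linked using (Linked)
  import Data.List.Relation.Unary.Linked.Properties as LinkedP
  import Data.List.Relation.Unary.Sorted.TotalOrder.Properties as SortedP
  import Data.List.Sort.InsertionSort as InsertionSort
  import Data.List.Sort.InsertionSort.Properties as InsertionSortP
  open import Data.List using (applyUpTo; reverse)
  open import Data.Nat using (_+_; _≥_; _≟_)
  open import Data.Vec using (tabulate; fromList)
  open import Function using (flip)
  open import Relation.Binary.Definitions using (Transitive)
  open import Relation.Binary.PropositionalEquality
  open import Relation.Nullary using (¬?; contradiction)

  Positive : List ℕ → Set
  Positive = All (1 ≤_)

  psumsFrom : ℕ → List ℕ → List ℕ
  psumsFrom s []       = []
  psumsFrom s (x ∷ xs) = (s + x) ∷ psumsFrom (s + x) xs

  psums-cons : ∀ s xs → psums (s ∷ xs) ≡ s ∷ psumsFrom s xs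
  psums-cons s []       = refl
  psums-cons s (x ∷ xs) = cong (s ∷_) (psums-cons (s + x) xs)

  psums≡psumsFrom0 : ∀ xs → psums xs ≡ psumsFrom 0 xs
  psums≡psumsFrom0 []       = refl
  psums≡psumsFrom0 (x ∷ xs) = psums-cons x xs

  member : ℕ → List ℕ → Bool
  member t = does ∘ any? (_≟ t)

  toList-tabulate : ∀ {m} (g : ℕ → Bool) → toList (tabulate {n = m} (g ∘ toℕ)) ≡ applyUpTo g m
  toList-tabulate {zero}  g = refl
  toList-tabulate {suc m} g = cong (g 0 ∷_) (toList-tabulate {m} (g ∘ suc))

  applyUpTo-cong : ∀ {A : Set} {f g : ℕ → A} m → (∀ k → f k ≡ g k) → applyUpTo f m ≡ applyUpTo g m
  applyUpTo-cong zero    eq = refl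
  applyUpTo-cong (suc m) eq = cong₂ _∷_ (eq 0) (applyUpTo-cong m (eq ∘ suc))

  sum-compAux : ∀ {m} r (X : Vec Bool m) → sum (compAux r X) ≡ r + m
  sum-compAux         r []          = refl
  sum-compAux {suc m} r (true ∷ X)  = cong (r +_) (sum-compAux 1 X)
  sum-compAux {suc m} r (false ∷ X) = trans (sum-compAux (suc r) X) (sym (ℕP.+-suc r m))

  member-absent : ∀ t P → All (¬_ ∘ (_≡ t)) P → member t P ≡ false
  member-absent t []      []         = refl
  member-absent t (y ∷ P) (y≢t ∷ ps) rewrite dec-false (y ≟ t) y≢t = member-absent t P ps

  psumsFrom-compAux-≥ : ∀ {m} s r (X : Vec Bool m) → All (s + r ≤_) (psumsFrom s (compAux r X))
  psumsFrom-compAux-≥ s r []          = ℕP.≤-refl ∷ []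
  psumsFrom-compAux-≥ s r (true ∷ X)  =
    ℕP.≤-refl ∷ All.map (ℕP.≤-trans (ℕP.m≤m+n (s + r) 1)) (psumsFrom-compAux-≥ (s + r) 1 X)
  psumsFrom-compAux-≥ s r (false ∷ X) =
    All.map (ℕP.≤-trans (ℕP.+-monoʳ-≤ s (ℕP.n≤1+n r))) (psumsFrom-compAux-≥ s (suc r) X)

  member-psumsFrom-compAux : ∀ {m} s r (X : Vec Bool m) →
    applyUpTo (λ k → member (s + r + k) (psumsFrom s (compAux r X))) m ≡ toList X
  member-psumsFrom-compAux s r [] = refl
  member-psumsFrom-compAux s r (true ∷ X) =
    cong₂ _∷_ head (trans (applyUpTo-cong _ shift) (member-psumsFrom-compAux (s + r) 1 X))
    where
    head : member (s + r + 0) ((s + r) ∷ psumsFrom (s + r) (compAux 1 X)) ≡ true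
    head rewrite ℕP.+-identityʳ (s + r) | dec-true ((s + r) ≟ (s + r)) refl = refl
    shift : ∀ k → member (s + r + suc k) ((s + r) ∷ psumsFrom (s + r) (compAux 1 X))
                ≡ member (s + r + 1 + k) (psumsFrom (s + r) (compAux 1 X))
    shift k rewrite dec-false ((s + r) ≟ (s + r + suc k))
                      (λ e → ℕP.m≢1+m+n (s + r) (trans e (ℕP.+-suc (s + r) k)))
                  | ℕP.+-suc (s + r) k | ℕP.+-comm (s + r) 1 = refl
  member-psumsFrom-compAux s r (false ∷ X) =
    cong₂ _∷_ head (trans (applyUpTo-cong _ shift) (member-psumsFrom-compAux s (suc r) X))
    where
    head : member (s + r + 0) (psumsFrom s (compAux (suc r) X)) ≡ false
    head = member-absent _ _ (All.map (λ p e → ℕP.<-irrefl (sym (trans e (ℕP.+-identityʳ (s + r))))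
             (ℕP.<-≤-trans (ℕP.+-monoʳ-< s (ℕP.n<1+n r)) p)) (psumsFrom-compAux-≥ s (suc r) X))
    shift : ∀ k → member (s + r + suc k) (psumsFrom s (compAux (suc r) X))
                ≡ member (s + suc r + k) (psumsFrom s (compAux (suc r) X))
    shift k rewrite ℕP.+-suc s r | ℕP.+-suc (s + r) k = refl

  setC-compAux : ∀ {m} (X : Vec Bool m) → toList (setC (compAux 1 X)) ≡ toList X
  setC-compAux {m} X = begin
    toList (setC (compAux 1 X))
      ≡⟨ toList-tabulate (λ k → member (suc k) (psums (compAux 1 X))) ⟩
    applyUpTo (λ k → member (suc k) (psums (compAux 1 X))) (sum (compAux 1 X) ∸ 1)
      ≡⟨ cong₂ (λ n P → applyUpTo (λ k → member (suc k) P) n)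
               (cong (_∸ 1) (sum-compAux 1 X)) (psums≡psumsFrom0 (compAux 1 X)) ⟩
    applyUpTo (λ k → member (0 + 1 + k) (psumsFrom 0 (compAux 1 X))) m
      ≡⟨ member-psumsFrom-compAux 0 1 X ⟩
    toList X ∎
    where open ≡-Reasoning

  sum-comp : ∀ n (X : Subset (n ∸ 1)) → 1 ≤ n → sum (comp n X) ≡ n
  sum-comp (suc m) X _ = sum-compAux 1 X

  setC-comp : ∀ n (X : Subset (n ∸ 1)) → 1 ≤ n → toList (setC (comp n X)) ≡ toList X
  setC-comp (suc m) X _ = setC-compAux X

  setPattern : List ℕ → List Bool
  setPattern []          = []
  setPattern (x ∷ [])    = replicate (x ∸ 1) false
  setPattern (x ∷ y ∷ β) = replicate (x ∸ 1) false ++ true ∷ setPattern (y ∷ β)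

  compAux-falses : ∀ r d (l : List Bool) →
    compAux r (fromList (replicate d false ++ l)) ≡ compAux (d + r) (fromList l)
  compAux-falses r zero    l = refl
  compAux-falses r (suc d) l =
    trans (compAux-falses (suc r) d l) (cong (λ z → compAux z (fromList l)) (ℕP.+-suc d r))

  ∸1+1 : ∀ {x} → 1 ≤ x → x ∸ 1 + 1 ≡ x
  ∸1+1 {suc x} _ = ℕP.+-comm x 1

  compAux-setPattern : ∀ x β → Positive (x ∷ β) → compAux 1 (fromList (setPattern (x ∷ β))) ≡ x ∷ β
  compAux-setPattern x [] (x≥1 ∷ _) = begin
    compAux 1 (fromList (replicate (x ∸ 1) false))
      ≡⟨ cong (compAux 1 ∘ fromList) (sym (ListP.++-identityʳ (replicate (x ∸ 1) false))) ⟩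
    compAux 1 (fromList (replicate (x ∸ 1) false ++ []))
      ≡⟨ compAux-falses 1 (x ∸ 1) [] ⟩
    (x ∸ 1 + 1) ∷ []
      ≡⟨ cong (_∷ []) (∸1+1 x≥1) ⟩
    x ∷ [] ∎
    where open ≡-Reasoning
  compAux-setPattern x (y ∷ β) (x≥1 ∷ ps) =
    trans (compAux-falses 1 (x ∸ 1) (true ∷ setPattern (y ∷ β)))
          (cong₂ _∷_ (∸1+1 x≥1) (compAux-setPattern y β ps))

  setC≡setPattern : ∀ {α} → Positive α → toList (setC α) ≡ setPattern α
  setC≡setPattern {[]}    _  = refl
  setC≡setPattern {x ∷ β} ps =
    subst (λ γ → toList (setC γ) ≡ setPattern (x ∷ β)) (compAux-setPattern x β ps)
      (trans (setC-compAux (fromList (setPattern (x ∷ β)))) (VecP.toList∘fromList (setPattern (x ∷ β))))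

  sum-positive : ∀ {x β} → Positive (x ∷ β) → 1 ≤ sum (x ∷ β)
  sum-positive {x} {β} (x≥1 ∷ _) = ℕP.≤-trans x≥1 (ℕP.m≤m+n x (sum β))

  setC-ᶜ≡map-not : ∀ {α} → Positive α → toList (setC (α ᶜ)) ≡ map not (setPattern α)
  setC-ᶜ≡map-not {[]}    _  = refl
  setC-ᶜ≡map-not {x ∷ β} ps = begin
    toList (setC ((x ∷ β) ᶜ))            ≡⟨ setC-comp (sum (x ∷ β)) _ (sum-positive ps) ⟩
    toList (∁ (setC (x ∷ β)))            ≡⟨ VecP.toList-map not (setC (x ∷ β)) ⟩
    map not (toList (setC (x ∷ β)))      ≡⟨ cong (map not) (setC≡setPattern ps) ⟩
    map not (setPattern (x ∷ β))         ∎
    where open ≡-Reasoning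

  sum-ᶜ-positive : ∀ {x β} → Positive (x ∷ β) → 1 ≤ sum ((x ∷ β) ᶜ)
  sum-ᶜ-positive {x} {β} ps =
    subst (1 ≤_) (sym (sum-comp (sum (x ∷ β)) _ (sum-positive ps))) (sum-positive ps)

  private
    module Sort = InsertionSort ℕP.≤-decTotalOrder
    module SortP = InsertionSortP ℕP.≤-decTotalOrder

  AllPairs-reverse : ∀ {R : ℕ → ℕ → Set} {xs} → AllPairs R xs → AllPairs (flip R) (reverse xs)
  AllPairs-reverse [] = []
  AllPairs-reverse {R} {x ∷ xs} (rx ∷ rxs) = subst (AllPairs (flip R)) (sym (ListP.unfold-reverse x xs))
    (AllPairsP.++⁺ (AllPairs-reverse rxs) ([] ∷ [])
      (All.map (_∷ []) (All-resp-↭ (↭-sym (↭-reverse xs)) rx)))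

  Linked-reverse : ∀ {R : ℕ → ℕ → Set} → Transitive R →
    ∀ {xs} → Linked R xs → Linked (flip R) (reverse xs)
  Linked-reverse R-trans l =
    LinkedP.AllPairs⇒Linked (AllPairs-reverse (LinkedP.Linked⇒AllPairs R-trans l))

  Descending : List ℕ → Set
  Descending = Linked _≥_

  descending-↭⇒≡ : ∀ {xs ys} → Descending xs → Descending ys → xs ↭ ys → xs ≡ ys
  descending-↭⇒≡ {xs} {ys} dx dy p = begin
    xs                   ≡⟨ sym (ListP.reverse-involutive xs) ⟩
    reverse (reverse xs) ≡⟨ cong reverse (Pointwise-≡⇒≡ (SortedP.↗↭↗⇒≋ ℕP.≤-totalOrder
                              (ascending dx) (ascending dy)
                              (↭⇒↭ₛ (↭-trans (↭-reverse xs) (↭-trans p (↭-sym (↭-reverse ys))))))) ⟩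
    reverse (reverse ys) ≡⟨ ListP.reverse-involutive ys ⟩
    ys                   ∎
    where
    open ≡-Reasoning
    ascending : ∀ {zs} → Descending zs → Linked _≤_ (reverse zs)
    ascending = Linked-reverse (flip ℕP.≤-trans)

  sortDesc-↭ : ∀ xs → sortDesc xs ↭ xs
  sortDesc-↭ xs = ↭-trans (↭-reverse (Sort.sort xs)) (SortP.sort-↭ xs)

  sortDesc-descending : ∀ xs → Descending (sortDesc xs)
  sortDesc-descending xs = Linked-reverse ℕP.≤-trans (SortP.sort-↗ xs)

  sortDesc-cong : ∀ {xs ys} → xs ↭ ys → sortDesc xs ≡ sortDesc ys
  sortDesc-cong {xs} {ys} p = descending-↭⇒≡ (sortDesc-descending xs) (sortDesc-descending ys)
    (↭-trans (sortDesc-↭ xs) (↭-trans p (↭-sym (sortDesc-↭ ys))))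

  sortDesc-id : ∀ {xs} → Descending xs → sortDesc xs ≡ xs
  sortDesc-id {xs} d = descending-↭⇒≡ (sortDesc-descending xs) d (sortDesc-↭ xs)

  positiveParts : List ℕ → List ℕ
  positiveParts = filter (λ x → ¬? (x ≟ 0))

  positiveParts-positive : ∀ xs → Positive (positiveParts xs)
  positiveParts-positive xs = All.map (λ { {zero} x≢0 → contradiction refl x≢0 ; {suc _} _ → s≤s z≤n })
    (AllP.all-filter (λ x → ¬? (x ≟ 0)) xs)

  positiveParts-id : ∀ {xs} → Positive xs → positiveParts xs ≡ xs
  positiveParts-id ps = ListP.filter-all (λ x → ¬? (x ≟ 0)) (All.map (λ { (s≤s _) () }) ps)

  -- WithRing.shape R unfolds to shapeOf for every ring R.
  shapeOf : List ℕ → List ℕ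
  shapeOf κ = sortDesc (positiveParts κ)

  shapeOf-cong : ∀ {xs ys} → xs ↭ ys → shapeOf xs ≡ shapeOf ys
  shapeOf-cong p = sortDesc-cong (filter-↭ (λ x → ¬? (x ≟ 0)) p)

  shapeOf-partition : ∀ κ → IsPartition (shapeOf κ)
  shapeOf-partition κ =
    All-resp-↭ (↭-sym (sortDesc-↭ _)) (positiveParts-positive κ) , sortDesc-descending (positiveParts κ)

  shapeOf-id : ∀ {ν} → IsPartition ν → shapeOf ν ≡ ν
  shapeOf-id {ν} (ps , d) = trans (cong sortDesc (positiveParts-id ps)) (sortDesc-id d)

  shapeOf-↭ : ∀ {w} → Positive w → shapeOf w ↭ w
  shapeOf-↭ {w} ps = subst (λ z → sortDesc z ↭ w) (sym (positiveParts-id ps)) (sortDesc-↭ w)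

  length-shapeOf : ∀ {w} → Positive w → length (shapeOf w) ≡ length w
  length-shapeOf ps = ↭-length (shapeOf-↭ ps)

  sum-shapeOf : ∀ {w} → Positive w → sum (shapeOf w) ≡ sum w
  sum-shapeOf ps = ℕListP.sum-↭ (shapeOf-↭ ps)

  length≤sum : ∀ {w} → Positive w → length w ≤ sum w
  length≤sum []       = z≤n
  length≤sum (p ∷ ps) = ℕP.+-mono-≤ p (length≤sum ps)

open Combinatorics

-- Pairing formal combinations with functions on words

infix 4 _≟ₗ_
_≟ₗ_ : DecidableEquality (List ℕ)
_≟ₗ_ = ListP.≡-dec ℕ._≟_

module _ {c ℓ} (R : CommutativeRing c ℓ) where

  open CommutativeRing R
  open WithRing R
  open import Relation.Binary.Reasoning.Setoid setoid
  open import Algebra.Properties.CommutativeSemigroup +-commutativeSemigroup using (interchange)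
  open import Algebra.Properties.CommutativeSemigroup *-commutativeSemigroup
    using (x∙yz≈y∙xz) renaming (interchange to *-interchange)
  open import Algebra.Definitions _≈_ using (RightInvertible)

  if-cong : ∀ d {x y} → x ≈ y → (if d then x else 0#) ≈ (if d then y else 0#)
  if-cong true  x≈y = x≈y
  if-cong false _   = refl

  if-zero : ∀ d {x} → x ≈ 0# → (if d then x else 0#) ≈ 0#
  if-zero true  x≈0 = x≈0
  if-zero false _   = refl

  *-if : ∀ d x y → x * (if d then y else 0#) ≈ (if d then x * y else 0#)
  *-if true  x y = refl
  *-if false x y = zeroʳ x

  if-yes : ∀ {p} {P : Set p} (P? : Dec P) {x} → P → (if does P? then x else 0#) ≈ x
  if-yes P? {x} p = reflexive (≡.cong (λ d → if d then x else 0#) (dec-true P? p))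

  if-no : ∀ {p} {P : Set p} (P? : Dec P) {x} → ¬ P → (if does P? then x else 0#) ≈ 0#
  if-no P? {x} ¬p = reflexive (≡.cong (λ d → if d then x else 0#) (dec-false P? ¬p))

  module _ {a} {A : Set a} where

    sumOver : List A → (A → Carrier) → Carrier
    sumOver []      F = 0#
    sumOver (x ∷ L) F = F x + sumOver L F

    sumOver-cong : ∀ L {F G : A → Carrier} → (∀ x → F x ≈ G x) → sumOver L F ≈ sumOver L G
    sumOver-cong []      F≈G = refl
    sumOver-cong (x ∷ L) F≈G = +-cong (F≈G x) (sumOver-cong L F≈G)

    sumOver-++ : ∀ L M (F : A → Carrier) → sumOver (L ++ M) F ≈ sumOver L F + sumOver M F
    sumOver-++ []      M F = sym (+-identityˡ _)
    sumOver-++ (x ∷ L) M F = trans (+-congˡ (sumOver-++ L M F)) (sym (+-assoc _ _ _))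

    sumOver-*ˡ : ∀ L y (F : A → Carrier) → sumOver L (λ x → y * F x) ≈ y * sumOver L F
    sumOver-*ˡ []      y F = sym (zeroʳ y)
    sumOver-*ˡ (x ∷ L) y F = trans (+-congˡ (sumOver-*ˡ L y F)) (sym (distribˡ _ _ _))

    sumOver-+ : ∀ L (F G : A → Carrier) → sumOver L (λ x → F x + G x) ≈ sumOver L F + sumOver L G
    sumOver-+ []      F G = sym (+-identityˡ 0#)
    sumOver-+ (x ∷ L) F G = trans (+-congˡ (sumOver-+ L F G)) (interchange _ _ _ _)

    sumOver-0 : ∀ L → sumOver L (λ (_ : A) → 0#) ≈ 0#
    sumOver-0 []      = refl
    sumOver-0 (x ∷ L) = trans (+-identityˡ _) (sumOver-0 L)

    sumOver-congᴬ : ∀ L {F G : A → Carrier} → All (λ x → F x ≈ G x) L → sumOver L F ≈ sumOver L G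
    sumOver-congᴬ []      []            = refl
    sumOver-congᴬ (x ∷ L) (Fx≈Gx ∷ F≈G) = +-cong Fx≈Gx (sumOver-congᴬ L F≈G)

    sumOver-if : ∀ L d (F : A → Carrier) →
      sumOver L (λ x → if d then F x else 0#) ≈ (if d then sumOver L F else 0#)
    sumOver-if L true  F = refl
    sumOver-if L false F = sumOver-0 L

    sumOver-unique : ∀ {b} {B : Set b} (_≟_ : DecidableEquality B) (key : A → B) L (F : A → Carrier) {t} →
      Unique (map key L) → t ∈ L → sumOver L (λ s → if does (key s ≟ key t) then F s else 0#) ≈ F t
    sumOver-unique _≟_ key (s ∷ L) F (s∉L ∷ _) (here ≡.refl) = begin
      (if does (key s ≟ key s) then F s else 0#)
        + sumOver L (λ s′ → if does (key s′ ≟ key s) then F s′ else 0#)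
        ≈⟨ +-cong (if-yes (key s ≟ key s) ≡.refl)
                  (trans (sumOver-congᴬ L (All.map (λ s′≢s → if-no (_ ≟ key s) (s′≢s ∘ ≡.sym))
                                                           (AllP.map⁻ s∉L)))
                         (sumOver-0 L)) ⟩
      F s + 0# ≈⟨ +-identityʳ _ ⟩
      F s ∎
    sumOver-unique _≟_ key (s ∷ L) F {t} (s∉L ∷ unique) (there t∈L) = begin
      (if does (key s ≟ key t) then F s else 0#)
        + sumOver L (λ s′ → if does (key s′ ≟ key t) then F s′ else 0#)
        ≈⟨ +-cong (if-no (key s ≟ key t) (All.lookup s∉L (∈P.∈-map⁺ key t∈L)))
                  (sumOver-unique _≟_ key L F unique t∈L) ⟩
      0# + F t ≈⟨ +-identityˡ _ ⟩
      F t ∎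

    sumOver-filter : ∀ {p} {P : A → Set p} (P? : Decidable P) L (F : A → Carrier) →
      sumOver (filter P? L) F ≈ sumOver L (λ x → if does (P? x) then F x else 0#)
    sumOver-filter P? []      F = refl
    sumOver-filter P? (x ∷ L) F with does (P? x)
    ... | true  = +-congˡ (sumOver-filter P? L F)
    ... | false = trans (sumOver-filter P? L F) (sym (+-identityˡ _))

  sumOver-map : ∀ {a b} {A : Set a} {B : Set b} (h : A → B) L (F : B → Carrier) →
    sumOver (map h L) F ≡ sumOver L (λ x → F (h x))
  sumOver-map h []      F = ≡.refl
  sumOver-map h (x ∷ L) F = ≡.cong (F (h x) +_) (sumOver-map h L F)

  sumOver-swap : ∀ {a b} {A : Set a} {B : Set b} (L : List A) (M : List B) (F : A → B → Carrier) →
    sumOver L (λ x → sumOver M (F x)) ≈ sumOver M (λ y → sumOver L (λ x → F x y))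
  sumOver-swap []      M F = sym (sumOver-0 M)
  sumOver-swap (x ∷ L) M F = trans (+-congˡ (sumOver-swap L M F)) (sym (sumOver-+ M (F x) _))

  eval : Sym → (List ℕ → Carrier) → Carrier
  eval f ψ = sumOver f (λ t → proj₁ t * ψ (proj₂ t))

  eval-cong : ∀ f {ψ φ : List ℕ → Carrier} → (∀ w → ψ w ≈ φ w) → eval f ψ ≈ eval f φ
  eval-cong f ψ≈φ = sumOver-cong f (λ t → *-congˡ (ψ≈φ (proj₂ t)))

  eval-++ : ∀ f g ψ → eval (f ++ g) ψ ≈ eval f ψ + eval g ψ
  eval-++ f g ψ = sumOver-++ f g _

  eval-·S : ∀ x f ψ → eval (x ·S f) ψ ≈ x * eval f ψ
  eval-·S x f ψ = begin
    eval (x ·S f) ψ                            ≡⟨ sumOver-map _ f _ ⟩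
    sumOver f (λ t → x * proj₁ t * ψ (proj₂ t))  ≈⟨ sumOver-cong f (λ t → *-assoc _ _ _) ⟩
    sumOver f (λ t → x * (proj₁ t * ψ (proj₂ t))) ≈⟨ sumOver-*ˡ f x _ ⟩
    x * eval f ψ                               ∎

  eval-comm : ∀ f ψ → eval (comm f) ψ ≡ eval f ψ
  eval-comm f ψ = sumOver-map _ f _

  eval-*S : ∀ f g ψ → eval (f *S g) ψ ≈ eval f (λ w → eval g (λ u → ψ (w ++ u)))
  eval-*S []            g ψ = refl
  eval-*S ((x , w) ∷ f) g ψ = begin
    eval (x·w·g ++ f *S g) ψ                          ≈⟨ eval-++ x·w·g (f *S g) ψ ⟩
    eval x·w·g ψ + eval (f *S g) ψ                    ≈⟨ +-cong head (eval-*S f g ψ) ⟩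
    x * eval g (λ u → ψ (w ++ u)) + eval f (λ w → eval g (λ u → ψ (w ++ u))) ∎
    where
    x·w·g : Sym
    x·w·g = map (λ u → (x * proj₁ u , w ++ proj₂ u)) g
    head : eval x·w·g ψ ≈ x * eval g (λ u → ψ (w ++ u))
    head = begin
      eval x·w·g ψ                                         ≡⟨ sumOver-map _ g _ ⟩
      sumOver g (λ u → x * proj₁ u * ψ (w ++ proj₂ u))      ≈⟨ sumOver-cong g (λ u → *-assoc _ _ _) ⟩
      sumOver g (λ u → x * (proj₁ u * ψ (w ++ proj₂ u)))    ≈⟨ sumOver-*ˡ g x _ ⟩
      x * eval g (λ u → ψ (w ++ u))                         ∎

  eval-swap : ∀ f g (Ψ : List ℕ → List ℕ → Carrier) →
    eval f (λ w → eval g (Ψ w)) ≈ eval g (λ u → eval f (λ w → Ψ w u))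
  eval-swap f g Ψ = begin
    sumOver f (λ t → proj₁ t * sumOver g (λ s → proj₁ s * Ψ (proj₂ t) (proj₂ s)))
      ≈⟨ sumOver-cong f (λ t → sym (sumOver-*ˡ g (proj₁ t) _)) ⟩
    sumOver f (λ t → sumOver g (λ s → proj₁ t * (proj₁ s * Ψ (proj₂ t) (proj₂ s))))
      ≈⟨ sumOver-cong f (λ t → sumOver-cong g (λ s → x∙yz≈y∙xz _ _ _)) ⟩
    sumOver f (λ t → sumOver g (λ s → proj₁ s * (proj₁ t * Ψ (proj₂ t) (proj₂ s))))
      ≈⟨ sumOver-swap f g _ ⟩
    sumOver g (λ s → sumOver f (λ t → proj₁ s * (proj₁ t * Ψ (proj₂ t) (proj₂ s))))
      ≈⟨ sumOver-cong g (λ s → sumOver-*ˡ f (proj₁ s) _) ⟩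
    sumOver g (λ s → proj₁ s * sumOver f (λ t → proj₁ t * Ψ (proj₂ t) (proj₂ s))) ∎

  δ : List ℕ → List ℕ → Carrier
  δ μ w = if does (shape w ≟ₗ μ) then 1# else 0#

  coeff≈eval-δ : ∀ f μ → coeff f μ ≈ eval f (δ μ)
  coeff≈eval-δ []            μ = refl
  coeff≈eval-δ ((x , w) ∷ f) μ with does (shape w ≟ₗ μ)
  ... | true  = +-cong (sym (*-identityʳ x)) (coeff≈eval-δ f μ)
  ... | false = trans (coeff≈eval-δ f μ) (sym (trans (+-congʳ (zeroʳ x)) (+-identityˡ _)))

  coeff-++ : ∀ f g μ → coeff (f ++ g) μ ≈ coeff f μ + coeff g μ
  coeff-++ f g μ = trans (coeff≈eval-δ (f ++ g) μ)
    (trans (eval-++ f g (δ μ)) (sym (+-cong (coeff≈eval-δ f μ) (coeff≈eval-δ g μ))))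

  coeff-·S : ∀ x f μ → coeff (x ·S f) μ ≈ x * coeff f μ
  coeff-·S x f μ = trans (coeff≈eval-δ (x ·S f) μ)
    (trans (eval-·S x f (δ μ)) (*-congˡ (sym (coeff≈eval-δ f μ))))

  coeff-monomial : ∀ x w μ → coeff ((x , w) ∷ []) μ ≈ (if does (shape w ≟ₗ μ) then x else 0#)
  coeff-monomial x w μ with does (shape w ≟ₗ μ)
  ... | true  = +-identityʳ x
  ... | false = refl

  coeff-lincomb : ∀ (b : List ℕ → Sym) cs μ →
    coeff (lincomb cs b) μ ≈ sumOver cs (λ t → proj₁ t * coeff (b (proj₂ t)) μ)
  coeff-lincomb b []             μ = refl
  coeff-lincomb b ((x , λ′) ∷ cs) μ = begin
    coeff (x ·S b λ′ ++ lincomb cs b) μ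
      ≈⟨ coeff-++ (x ·S b λ′) (lincomb cs b) μ ⟩
    coeff (x ·S b λ′) μ + coeff (lincomb cs b) μ
      ≈⟨ +-cong (coeff-·S x (b λ′) μ) (coeff-lincomb b cs μ) ⟩
    x * coeff (b λ′) μ + sumOver cs (λ t → proj₁ t * coeff (b (proj₂ t)) μ) ∎

  coeff-filter-shape : ∀ {p} {P : List ℕ → Set p} (P? : Decidable P) f μ →
    coeff (filter (λ t → P? (shape (proj₂ t))) f) μ ≈ (if does (P? μ) then coeff f μ else 0#)
  coeff-filter-shape P? f μ = begin
    coeff (filter (λ t → P? (shape (proj₂ t))) f) μ
      ≈⟨ coeff≈eval-δ (filter (λ t → P? (shape (proj₂ t))) f) μ ⟩
    eval (filter (λ t → P? (shape (proj₂ t))) f) (δ μ)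
      ≈⟨ sumOver-filter (λ t → P? (shape (proj₂ t))) f _ ⟩
    sumOver f (λ t → if does (P? (shape (proj₂ t))) then proj₁ t * δ μ (proj₂ t) else 0#)
      ≈⟨ sumOver-cong f (λ t → same-shape (proj₂ t) (proj₁ t)) ⟩
    sumOver f (λ t → if does (P? μ) then proj₁ t * δ μ (proj₂ t) else 0#)
      ≈⟨ sumOver-if f (does (P? μ)) _ ⟩
    (if does (P? μ) then eval f (δ μ) else 0#)
      ≈⟨ if-cong (does (P? μ)) (sym (coeff≈eval-δ f μ)) ⟩
    (if does (P? μ) then coeff f μ else 0#) ∎
    where
    same-shape : ∀ w x → (if does (P? (shape w)) then x * δ μ w else 0#)
                       ≈ (if does (P? μ) then x * δ μ w else 0#)
    same-shape w x with shape w ≟ₗ μ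
    ... | yes ≡.refl = refl
    ... | no  _      = trans (if-zero (does (P? (shape w))) (zeroʳ x)) (sym (if-zero (does (P? μ)) (zeroʳ x)))

  *-invertible : ∀ {x y} → RightInvertible 1# _*_ x → RightInvertible 1# _*_ y → RightInvertible 1# _*_ (x * y)
  *-invertible (x⁻¹ , xx⁻¹≈1) (y⁻¹ , yy⁻¹≈1) =
    x⁻¹ * y⁻¹ , trans (*-interchange _ _ _ _) (trans (*-cong xx⁻¹≈1 yy⁻¹≈1) (*-identityˡ 1#))

  pow-invertible : ∀ {x} → RightInvertible 1# _*_ x → ∀ k → RightInvertible 1# _*_ (pow x k)
  pow-invertible x-inv zero    = 1# , *-identityˡ 1#
  pow-invertible x-inv (suc k) = *-invertible x-inv (pow-invertible x-inv k)

  invertible-cancelʳ : ∀ {x u} → RightInvertible 1# _*_ u → x * u ≈ 0# → x ≈ 0#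
  invertible-cancelʳ {x} {u} (u⁻¹ , uu⁻¹≈1) xu≈0 = begin
    x              ≈⟨ *-identityʳ x ⟨
    x * 1#         ≈⟨ *-congˡ uu⁻¹≈1 ⟨
    x * (u * u⁻¹)  ≈⟨ *-assoc x u u⁻¹ ⟨
    x * u * u⁻¹    ≈⟨ *-congʳ xu≈0 ⟩
    0# * u⁻¹       ≈⟨ zeroˡ u⁻¹ ⟩
    0#             ∎

-- The elements 𝓑̂(a,b)_α

zipWith-ext : ∀ {m} {f g : Bool → Bool → Bool} → (∀ x y → f x y ≡ g x y) →
  (I J : Vec Bool m) → Vec.zipWith f I J ≡ Vec.zipWith g I J
zipWith-ext f≡g []      []      = ≡.refl
zipWith-ext f≡g (x ∷ I) (y ∷ J) = ≡.cong₂ _∷_ (f≡g x y) (zipWith-ext f≡g I J)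

─-∷ : ∀ {m} x y (I J : Subset m) → (x ∷ I) ─ (y ∷ J) ≡ (x ∧ not y) ∷ (I ─ J)
─-∷ x false I J =
  ≡.cong₂ _∷_ (≡.sym (∧-identityʳ x)) (zipWith-ext (λ { _ false → ≡.refl ; _ true → ≡.refl }) I J)
─-∷ x true  I J =
  ≡.cong₂ _∷_ (≡.sym (∧-zeroʳ x)) (zipWith-ext (λ { _ false → ≡.refl ; _ true → ≡.refl }) I J)

module _ {c ℓ} (R : CommutativeRing c ℓ) (a b : CommutativeRing.Carrier R) where

  open CommutativeRing R
  open WithRing R
  open import Relation.Binary.Reasoning.Setoid setoid
  open import Algebra.Properties.CommutativeSemigroup *-commutativeSemigroup using (x∙yz≈y∙xz)
  open import Algebra.Definitions _≈_ using (RightInvertible)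
  open import Algebra.Properties.Ring ring using (-1*x≈-x)

  -- cutSum r l ψ = Σ_J a^|l∖J| b^|l∩J| ψ(comp J) over J ⊇ [n-1]∖l, where the part under
  -- construction already has size r: a position outside l is always cut, one inside l
  -- is either cut (weight b) or merged into the current part (weight a).
  cutSum : ℕ → List Bool → (List ℕ → Carrier) → Carrier
  cutSum r []          ψ = ψ (r ∷ [])
  cutSum r (true ∷ l)  ψ = b * cutSum 1 l (λ w → ψ (r ∷ w)) + a * cutSum (suc r) l ψ
  cutSum r (false ∷ l) ψ = cutSum 1 l (λ w → ψ (r ∷ w))

  cutSum-cong : ∀ r l {ψ φ : List ℕ → Carrier} → (∀ w → ψ w ≈ φ w) → cutSum r l ψ ≈ cutSum r l φ
  cutSum-cong r []          ψ≈φ = ψ≈φ (r ∷ [])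
  cutSum-cong r (true ∷ l)  ψ≈φ =
    +-cong (*-congˡ (cutSum-cong 1 l (ψ≈φ ∘ (r ∷_)))) (*-congˡ (cutSum-cong (suc r) l ψ≈φ))
  cutSum-cong r (false ∷ l) ψ≈φ = cutSum-cong 1 l (ψ≈φ ∘ (r ∷_))

  cutSum-++ : ∀ r l l′ ψ →
    cutSum r (l ++ false ∷ l′) ψ ≈ cutSum r l (λ w → cutSum 1 l′ (λ u → ψ (w ++ u)))
  cutSum-++ r []          l′ ψ = refl
  cutSum-++ r (true ∷ l)  l′ ψ =
    +-cong (*-congˡ (cutSum-++ 1 l l′ (ψ ∘ (r ∷_)))) (*-congˡ (cutSum-++ (suc r) l l′ ψ))
  cutSum-++ r (false ∷ l) l′ ψ = cutSum-++ 1 l l′ (ψ ∘ (r ∷_))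

  summand : ∀ {m} → ℕ → Subset m → (List ℕ → Carrier) → Subset m → Carrier
  summand r I ψ J = if does (VecP.≡-dec Bool._≟_ (I ∪ J) ⊤)
    then pow a ∣ I ─ J ∣ * pow b ∣ I ∩ J ∣ * ψ (compAux r J) else 0#

  sumOver-subsets-suc : ∀ m (F : Subset (suc m) → Carrier) → sumOver R (subsets (suc m)) F
    ≈ sumOver R (subsets m) (λ J → F (true ∷ J)) + sumOver R (subsets m) (λ J → F (false ∷ J))
  sumOver-subsets-suc m F = begin
    sumOver R (map (true ∷_) (subsets m) ++ map (false ∷_) (subsets m)) F
      ≈⟨ sumOver-++ R (map (true ∷_) (subsets m)) _ F ⟩
    sumOver R (map (true ∷_) (subsets m)) F + sumOver R (map (false ∷_) (subsets m)) F
      ≡⟨ ≡.cong₂ _+_ (sumOver-map R (true ∷_) (subsets m) F) (sumOver-map R (false ∷_) (subsets m) F) ⟩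
    sumOver R (subsets m) (λ J → F (true ∷ J)) + sumOver R (subsets m) (λ J → F (false ∷ J)) ∎

  sumOver-summand : ∀ {m} r (I : Subset m) ψ → sumOver R (subsets m) (summand r I ψ) ≈ cutSum r (toList I) ψ
  sumOver-summand r [] ψ = trans (+-identityʳ _) (trans (*-congʳ (*-identityˡ 1#)) (*-identityˡ _))
  sumOver-summand {suc m} r (true ∷ I) ψ = begin
    sumOver R (subsets (suc m)) (summand r (true ∷ I) ψ)
      ≈⟨ sumOver-subsets-suc m _ ⟩
    sumOver R (subsets m) (λ J → summand r (true ∷ I) ψ (true ∷ J))
      + sumOver R (subsets m) (λ J → summand r (true ∷ I) ψ (false ∷ J))
      ≈⟨ +-cong (sumOver-cong R (subsets m) cut) (sumOver-cong R (subsets m) merge) ⟩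
    sumOver R (subsets m) (λ J → b * summand 1 I (ψ ∘ (r ∷_)) J)
      + sumOver R (subsets m) (λ J → a * summand (suc r) I ψ J)
      ≈⟨ +-cong (sumOver-*ˡ R (subsets m) b _) (sumOver-*ˡ R (subsets m) a _) ⟩
    b * sumOver R (subsets m) (summand 1 I (ψ ∘ (r ∷_)))
      + a * sumOver R (subsets m) (summand (suc r) I ψ)
      ≈⟨ +-cong (*-congˡ (sumOver-summand 1 I _)) (*-congˡ (sumOver-summand (suc r) I ψ)) ⟩
    cutSum r (true ∷ toList I) ψ ∎
    where
    cut : ∀ J → summand r (true ∷ I) ψ (true ∷ J) ≈ b * summand 1 I (ψ ∘ (r ∷_)) J
    cut J with does (VecP.≡-dec Bool._≟_ (I ∪ J) ⊤)
    ... | true  = trans (*-congʳ (trans (*-congʳ (reflexive (≡.cong (pow a ∘ ∣_∣) (─-∷ true true I J))))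
                   (x∙yz≈y∙xz _ _ _))) (*-assoc _ _ _)
    ... | false = sym (zeroʳ b)
    merge : ∀ J → summand r (true ∷ I) ψ (false ∷ J) ≈ a * summand (suc r) I ψ J
    merge J with does (VecP.≡-dec Bool._≟_ (I ∪ J) ⊤)
    ... | true  = trans (*-congʳ (trans (*-congʳ (reflexive (≡.cong (pow a ∘ ∣_∣) (─-∷ true false I J))))
                   (*-assoc _ _ _))) (*-assoc _ _ _)
    ... | false = sym (zeroʳ a)
  sumOver-summand {suc m} r (false ∷ I) ψ = begin
    sumOver R (subsets (suc m)) (summand r (false ∷ I) ψ)
      ≈⟨ sumOver-subsets-suc m _ ⟩
    sumOver R (subsets m) (λ J → summand r (false ∷ I) ψ (true ∷ J)) + sumOver R (subsets m) (λ _ → 0#)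
      ≈⟨ +-cong (sumOver-cong R (subsets m) cut) (sumOver-0 R (subsets m)) ⟩
    sumOver R (subsets m) (summand 1 I (ψ ∘ (r ∷_))) + 0#
      ≈⟨ +-identityʳ _ ⟩
    sumOver R (subsets m) (summand 1 I (ψ ∘ (r ∷_)))
      ≈⟨ sumOver-summand 1 I _ ⟩
    cutSum r (false ∷ toList I) ψ ∎
    where
    cut : ∀ J → summand r (false ∷ I) ψ (true ∷ J) ≈ summand 1 I (ψ ∘ (r ∷_)) J
    cut J with does (VecP.≡-dec Bool._≟_ (I ∪ J) ⊤)
    ... | true  = *-congʳ (*-congʳ (reflexive (≡.cong (pow a ∘ ∣_∣) (─-∷ false true I J))))
    ... | false = refl

  eval-Bsub : ∀ n (I : Subset (n ∸ 1)) → 1 ≤ n → ∀ ψ →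
    eval R (Bsub a b n I) ψ ≈ cutSum 1 (toList I) ψ
  eval-Bsub (suc m) I _ ψ = begin
    eval R (Bsub a b (suc m) I) ψ
      ≡⟨ sumOver-map R _ (List.filter (λ J → VecP.≡-dec Bool._≟_ (I ∪ J) ⊤) (subsets m)) _ ⟩
    sumOver R (List.filter (λ J → VecP.≡-dec Bool._≟_ (I ∪ J) ⊤) (subsets m)) _
      ≈⟨ sumOver-filter R (λ J → VecP.≡-dec Bool._≟_ (I ∪ J) ⊤) (subsets m) _ ⟩
    sumOver R (subsets m) (summand 1 I ψ)
      ≈⟨ sumOver-summand 1 I ψ ⟩
    cutSum 1 (toList I) ψ ∎

  v : List ℕ → Sym
  v α = comm (𝓑̂ a b α)

  eval-v-[] : ∀ ψ → eval R (v []) ψ ≈ ψ []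
  eval-v-[] ψ = sumOver-summand 0 [] (λ _ → ψ [])

  eval-v≈cutSum : ∀ {x β} → Positive (x ∷ β) → ∀ ψ →
    eval R (v (x ∷ β)) ψ ≈ cutSum 1 (map not (setPattern (x ∷ β))) ψ
  eval-v≈cutSum {x} {β} ps ψ = begin
    eval R (v (x ∷ β)) ψ
      ≡⟨ eval-comm R (𝓑̂ a b (x ∷ β)) ψ ⟩
    eval R (𝓑̂ a b (x ∷ β)) ψ
      ≈⟨ eval-Bsub _ (setC ((x ∷ β) ᶜ)) (sum-ᶜ-positive ps) ψ ⟩
    cutSum 1 (toList (setC ((x ∷ β) ᶜ))) ψ
      ≡⟨ ≡.cong (λ l → cutSum 1 l ψ) (setC-ᶜ≡map-not ps) ⟩
    cutSum 1 (map not (setPattern (x ∷ β))) ψ ∎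

  eval-v-[x] : ∀ {x} → 1 ≤ x → ∀ ψ → eval R (v [ x ]) ψ ≈ cutSum 1 (replicate (x ∸ 1) true) ψ
  eval-v-[x] {x} x≥1 ψ =
    trans (eval-v≈cutSum (x≥1 ∷ []) ψ)
          (reflexive (≡.cong (λ l → cutSum 1 l ψ) (ListP.map-replicate not (x ∸ 1) false)))

  -- The junction of x with y ∷ β is not in set((x ∷ y ∷ β)ᶜ), so every J cuts there.
  eval-v-∷∷ : ∀ {x y β} → Positive (x ∷ y ∷ β) → ∀ ψ →
    eval R (v (x ∷ y ∷ β)) ψ ≈ eval R (v [ x ]) (λ w → eval R (v (y ∷ β)) (λ u → ψ (w ++ u)))
  eval-v-∷∷ {x} {y} {β} ps@(x≥1 ∷ ps′) ψ = begin
    eval R (v (x ∷ y ∷ β)) ψ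
      ≈⟨ eval-v≈cutSum ps ψ ⟩
    cutSum 1 (map not (replicate (x ∸ 1) false ++ true ∷ setPattern (y ∷ β))) ψ
      ≡⟨ ≡.cong (λ l → cutSum 1 l ψ) (ListP.map-++ not (replicate (x ∸ 1) false) _) ⟩
    cutSum 1 (map not (replicate (x ∸ 1) false) ++ false ∷ map not (setPattern (y ∷ β))) ψ
      ≡⟨ ≡.cong (λ l → cutSum 1 (l ++ _) ψ) (ListP.map-replicate not (x ∸ 1) false) ⟩
    cutSum 1 (replicate (x ∸ 1) true ++ false ∷ map not (setPattern (y ∷ β))) ψ
      ≈⟨ cutSum-++ 1 (replicate (x ∸ 1) true) _ ψ ⟩
    cutSum 1 (replicate (x ∸ 1) true) (λ w → cutSum 1 (map not (setPattern (y ∷ β))) (λ u → ψ (w ++ u)))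
      ≈⟨ cutSum-cong 1 (replicate (x ∸ 1) true) (λ w → sym (eval-v≈cutSum ps′ _)) ⟩
    cutSum 1 (replicate (x ∸ 1) true) (λ w → eval R (v (y ∷ β)) (λ u → ψ (w ++ u)))
      ≈⟨ eval-v-[x] x≥1 _ ⟨
    eval R (v [ x ]) (λ w → eval R (v (y ∷ β)) (λ u → ψ (w ++ u))) ∎

  eval-v-++ : ∀ {α β} → Positive α → Positive β → ∀ ψ →
    eval R (v (α ++ β)) ψ ≈ eval R (v α) (λ w → eval R (v β) (λ u → ψ (w ++ u)))
  eval-v-++ {α} {[]} _ _ ψ = begin
    eval R (v (α ++ [])) ψ
      ≡⟨ ≡.cong (λ γ → eval R (v γ) ψ) (ListP.++-identityʳ α) ⟩
    eval R (v α) ψ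
      ≈⟨ eval-cong R (v α) (λ w → reflexive (≡.cong ψ (≡.sym (ListP.++-identityʳ w)))) ⟩
    eval R (v α) (λ w → ψ (w ++ []))
      ≈⟨ eval-cong R (v α) (λ w → eval-v-[] (λ u → ψ (w ++ u))) ⟨
    eval R (v α) (λ w → eval R (v []) (λ u → ψ (w ++ u))) ∎
  eval-v-++ {[]}         {y ∷ β} _  _  ψ = sym (eval-v-[] (λ w → eval R (v (y ∷ β)) (λ u → ψ (w ++ u))))
  eval-v-++ {x ∷ []}     {y ∷ β} pα pβ ψ = eval-v-∷∷ (AllP.++⁺ pα pβ) ψ
  eval-v-++ {x ∷ x′ ∷ α} {y ∷ β} pα@(x≥1 ∷ pα′) pβ ψ = begin
    eval R (v (x ∷ x′ ∷ α ++ y ∷ β)) ψ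
      ≈⟨ eval-v-∷∷ (x≥1 ∷ AllP.++⁺ pα′ pβ) ψ ⟩
    eval R (v [ x ]) (λ w → eval R (v (x′ ∷ α ++ y ∷ β)) (λ u → ψ (w ++ u)))
      ≈⟨ eval-cong R (v [ x ]) (λ w → eval-v-++ pα′ pβ (λ u → ψ (w ++ u))) ⟩
    eval R (v [ x ]) (λ w → eval R (v (x′ ∷ α)) (λ w′ → eval R (v (y ∷ β)) (λ u → ψ (w ++ (w′ ++ u)))))
      ≈⟨ eval-cong R (v [ x ]) (λ w → eval-cong R (v (x′ ∷ α)) (λ w′ → eval-cong R (v (y ∷ β))
           (λ u → reflexive (≡.cong ψ (≡.sym (ListP.++-assoc w w′ u)))))) ⟩
    eval R (v [ x ]) (λ w → eval R (v (x′ ∷ α)) (λ w′ → eval R (v (y ∷ β)) (λ u → ψ ((w ++ w′) ++ u))))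
      ≈⟨ eval-v-∷∷ pα _ ⟨
    eval R (v (x ∷ x′ ∷ α)) (λ w → eval R (v (y ∷ β)) (λ u → ψ (w ++ u))) ∎

  eval-v-∷ : ∀ {x β} → Positive (x ∷ β) → ∀ ψ →
    eval R (v (x ∷ β)) ψ ≈ eval R (v [ x ]) (λ w → eval R (v β) (λ u → ψ (w ++ u)))
  eval-v-∷ (x≥1 ∷ pβ) = eval-v-++ (x≥1 ∷ []) pβ

  Symmetric : (List ℕ → Carrier) → Set ℓ
  Symmetric ψ = ∀ {w w′} → w ↭ w′ → ψ w ≈ ψ w′

  eval-v-↭ : ∀ {α α′} → α ↭ α′ → Positive α → ∀ ψ → Symmetric ψ →
    eval R (v α) ψ ≈ eval R (v α′) ψ
  eval-v-↭ ↭.refl _ ψ _ = refl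
  eval-v-↭ {x ∷ α} {x ∷ α′} (↭.prep x p) pxα@(x≥1 ∷ pα) ψ sym-ψ = begin
    eval R (v (x ∷ α)) ψ
      ≈⟨ eval-v-∷ pxα ψ ⟩
    eval R (v [ x ]) (λ w → eval R (v α) (λ u → ψ (w ++ u)))
      ≈⟨ eval-cong R (v [ x ]) (λ w → eval-v-↭ p pα _ (sym-ψ ∘ ++⁺ˡ w)) ⟩
    eval R (v [ x ]) (λ w → eval R (v α′) (λ u → ψ (w ++ u)))
      ≈⟨ eval-v-∷ (x≥1 ∷ All-resp-↭ p pα) ψ ⟨
    eval R (v (x ∷ α′)) ψ ∎
  eval-v-↭ {x ∷ y ∷ α} {y ∷ x ∷ α′} (↭.swap x y p) (x≥1 ∷ y≥1 ∷ pα) ψ sym-ψ = begin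
    eval R (v (x ∷ y ∷ α)) ψ
      ≈⟨ split₂ (x≥1 ∷ y≥1 ∷ pα) ⟩
    eval R (v [ x ]) (λ w → eval R (v [ y ]) (λ w′ → eval R (v α) (λ u → ψ (w ++ w′ ++ u))))
      ≈⟨ eval-swap R (v [ x ]) (v [ y ]) _ ⟩
    eval R (v [ y ]) (λ w′ → eval R (v [ x ]) (λ w → eval R (v α) (λ u → ψ (w ++ w′ ++ u))))
      ≈⟨ eval-cong R (v [ y ]) (λ w′ → eval-cong R (v [ x ]) (λ w →
           trans (eval-v-↭ p pα _ (sym-ψ ∘ ++⁺ˡ w ∘ ++⁺ˡ w′))
                 (eval-cong R (v α′) (λ u → sym-ψ (shifts w w′))))) ⟩
    eval R (v [ y ]) (λ w′ → eval R (v [ x ]) (λ w → eval R (v α′) (λ u → ψ (w′ ++ w ++ u))))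
      ≈⟨ split₂ (y≥1 ∷ x≥1 ∷ All-resp-↭ p pα) ⟨
    eval R (v (y ∷ x ∷ α′)) ψ ∎
    where
    split₂ : ∀ {x y β} → Positive (x ∷ y ∷ β) → eval R (v (x ∷ y ∷ β)) ψ
      ≈ eval R (v [ x ]) (λ w → eval R (v [ y ]) (λ w′ → eval R (v β) (λ u → ψ (w ++ w′ ++ u))))
    split₂ {x} pxyβ@(_ ∷ pyβ) =
      trans (eval-v-∷ pxyβ ψ) (eval-cong R (v [ x ]) (λ w → eval-v-∷ pyβ (λ u → ψ (w ++ u))))
  eval-v-↭ (↭.trans p q) pα ψ sym-ψ =
    trans (eval-v-↭ p pα ψ sym-ψ) (eval-v-↭ q (All-resp-↭ p pα) ψ sym-ψ)

  δ-symmetric : ∀ ν → Symmetric (δ R ν)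
  δ-symmetric ν p = reflexive (≡.cong (λ κ → if does (κ ≟ₗ ν) then 1# else 0#) (shapeOf-cong p))

  multiplicative : Multiplicative v
  multiplicative λ′ μ (pλ , _) (pμ , _) ν = begin
    coeff (v λ′ *S v μ) ν
      ≈⟨ coeff≈eval-δ R (v λ′ *S v μ) ν ⟩
    eval R (v λ′ *S v μ) (δ R ν)
      ≈⟨ eval-*S R (v λ′) (v μ) (δ R ν) ⟩
    eval R (v λ′) (λ w → eval R (v μ) (λ u → δ R ν (w ++ u)))
      ≈⟨ eval-v-++ pλ pμ (δ R ν) ⟨
    eval R (v (λ′ ++ μ)) (δ R ν)
      ≈⟨ eval-v-↭ (↭.↭-sym (sortDesc-↭ (λ′ ++ μ))) (AllP.++⁺ pλ pμ) (δ R ν) (δ-symmetric ν) ⟩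
    eval R (v (λ′ ·P μ)) (δ R ν)
      ≈⟨ coeff≈eval-δ R (v (λ′ ·P μ)) ν ⟨
    coeff (v (λ′ ·P μ)) ν ∎

  -- Triangularity and the basis property

  VanishesFrom : ℕ → ℕ → (List ℕ → Carrier) → Set ℓ
  VanishesFrom s L φ = ∀ w → Positive w → sum w ≡ s → L ≤ length w → φ w ≈ 0#

  vanishesFrom-++ : ∀ {s t L M ψ w} → VanishesFrom (s ℕ.+ t) (L ℕ.+ M) ψ →
    Positive w → sum w ≡ s → L ≤ length w → VanishesFrom t M (λ u → ψ (w ++ u))
  vanishesFrom-++ {L = L} {M} {w = w} van pw sw lw u pu su lu = van (w ++ u) (AllP.++⁺ pw pu)
    (≡.trans (ℕListP.sum-++ w u) (≡.cong₂ ℕ._+_ sw su))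
    (≡.subst (L ℕ.+ M ≤_) (≡.sym (ListP.length-++ w)) (ℕP.+-mono-≤ lw lu))

  cutSum-vanishes : ∀ r l φ → 1 ≤ r → VanishesFrom (r ℕ.+ length l) 1 φ → cutSum r l φ ≈ 0#
  cutSum-vanishes r [] φ r≥1 van = van (r ∷ []) (r≥1 ∷ []) ≡.refl (s≤s z≤n)
  cutSum-vanishes r (true ∷ l) φ r≥1 van = begin
    b * cutSum 1 l (φ ∘ (r ∷_)) + a * cutSum (suc r) l φ
      ≈⟨ +-cong (*-congˡ (cutSum-vanishes 1 l _ (s≤s z≤n) cut))
                (*-congˡ (cutSum-vanishes (suc r) l φ (s≤s z≤n) merge)) ⟩
    b * 0# + a * 0#
      ≈⟨ +-cong (zeroʳ b) (zeroʳ a) ⟩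
    0# + 0#
      ≈⟨ +-identityʳ 0# ⟩
    0# ∎
    where
    cut : VanishesFrom (1 ℕ.+ length l) 1 (φ ∘ (r ∷_))
    cut = vanishesFrom-++ {L = 0} van (r≥1 ∷ []) (ℕP.+-identityʳ r) z≤n
    merge : VanishesFrom (suc r ℕ.+ length l) 1 φ
    merge = ≡.subst (λ s → VanishesFrom s 1 φ) (ℕP.+-suc r (length l)) van
  cutSum-vanishes r (false ∷ l) φ r≥1 van =
    cutSum-vanishes 1 l _ (s≤s z≤n) (vanishesFrom-++ {L = 0} van (r≥1 ∷ []) (ℕP.+-identityʳ r) z≤n)

  cutSum-top : ∀ r k φ → 1 ≤ r → VanishesFrom (k ℕ.+ r) 2 φ →
    cutSum r (replicate k true) φ ≈ pow a k * φ [ k ℕ.+ r ]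
  cutSum-top r zero    φ r≥1 van = sym (*-identityˡ _)
  cutSum-top r (suc k) φ r≥1 van = begin
    b * cutSum 1 (replicate k true) (φ ∘ (r ∷_)) + a * cutSum (suc r) (replicate k true) φ
      ≈⟨ +-cong (*-congˡ (cutSum-vanishes 1 (replicate k true) _ (s≤s z≤n) cut))
                (*-congˡ (cutSum-top (suc r) k φ (s≤s z≤n) merge)) ⟩
    b * 0# + a * (pow a k * φ [ k ℕ.+ suc r ])
      ≈⟨ +-cong (zeroʳ b) (sym (*-assoc _ _ _)) ⟩
    0# + a * pow a k * φ [ k ℕ.+ suc r ]
      ≈⟨ +-identityˡ _ ⟩
    pow a (suc k) * φ [ k ℕ.+ suc r ]
      ≡⟨ ≡.cong (λ n → pow a (suc k) * φ [ n ]) (ℕP.+-suc k r) ⟩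
    pow a (suc k) * φ [ suc k ℕ.+ r ] ∎
    where
    cut : VanishesFrom (1 ℕ.+ length (replicate k true)) 1 (φ ∘ (r ∷_))
    cut = vanishesFrom-++ {s = r} {L = 1}
      (≡.subst (λ s → VanishesFrom s 2 φ)
        (≡.trans (ℕP.+-comm (suc k) r) (≡.cong (λ n → r ℕ.+ suc n) (≡.sym (ListP.length-replicate k)))) van)
      (r≥1 ∷ []) (ℕP.+-identityʳ r) (s≤s z≤n)
    merge : VanishesFrom (k ℕ.+ suc r) 2 φ
    merge = ≡.subst (λ s → VanishesFrom s 2 φ) (≡.sym (ℕP.+-suc k r)) van

  1+length-replicate : ∀ {x} → 1 ≤ x → 1 ℕ.+ length (replicate (x ∸ 1) true) ≡ x
  1+length-replicate {suc x} _ = ≡.cong suc (ListP.length-replicate x)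

  eval-v-vanishes : ∀ {β} → Positive β → ∀ ψ → VanishesFrom (sum β) (length β) ψ →
    eval R (v β) ψ ≈ 0#
  eval-v-vanishes {[]} _ ψ van = trans (eval-v-[] ψ) (van [] [] ≡.refl z≤n)
  eval-v-vanishes {x ∷ β} pxβ@(x≥1 ∷ pβ) ψ van = begin
    eval R (v (x ∷ β)) ψ
      ≈⟨ eval-v-∷ pxβ ψ ⟩
    eval R (v [ x ]) (λ w → eval R (v β) (λ u → ψ (w ++ u)))
      ≈⟨ eval-v-[x] x≥1 _ ⟩
    cutSum 1 (replicate (x ∸ 1) true) (λ w → eval R (v β) (λ u → ψ (w ++ u)))
      ≈⟨ cutSum-vanishes 1 (replicate (x ∸ 1) true) _ (s≤s z≤n) (λ w pw sw lw →
           eval-v-vanishes pβ _ (vanishesFrom-++ {L = 1} van pw (≡.trans sw (1+length-replicate x≥1)) lw)) ⟩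
    0# ∎

  leadingCoeff : List ℕ → Carrier
  leadingCoeff []      = 1#
  leadingCoeff (x ∷ β) = pow a (x ∸ 1) * leadingCoeff β

  eval-v-top : ∀ {β} → Positive β → ∀ ψ → VanishesFrom (sum β) (suc (length β)) ψ →
    eval R (v β) ψ ≈ leadingCoeff β * ψ β
  eval-v-top {[]} _ ψ _ = trans (eval-v-[] ψ) (sym (*-identityˡ _))
  eval-v-top {x ∷ β} pxβ@(x≥1 ∷ pβ) ψ van = begin
    eval R (v (x ∷ β)) ψ
      ≈⟨ eval-v-∷ pxβ ψ ⟩
    eval R (v [ x ]) (λ w → eval R (v β) (λ u → ψ (w ++ u)))
      ≈⟨ eval-v-[x] x≥1 _ ⟩
    cutSum 1 (replicate (x ∸ 1) true) (λ w → eval R (v β) (λ u → ψ (w ++ u)))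
      ≈⟨ cutSum-top 1 (x ∸ 1) _ (s≤s z≤n) (λ w pw sw lw →
           eval-v-vanishes pβ _ (vanishesFrom-++ {L = 2} van pw (≡.trans sw (∸1+1 x≥1)) lw)) ⟩
    pow a (x ∸ 1) * eval R (v β) (λ u → ψ ((x ∸ 1 ℕ.+ 1) ∷ u))
      ≡⟨ ≡.cong (λ n → pow a (x ∸ 1) * eval R (v β) (λ u → ψ (n ∷ u))) (∸1+1 x≥1) ⟩
    pow a (x ∸ 1) * eval R (v β) (λ u → ψ (x ∷ u))
      ≈⟨ *-congˡ (eval-v-top pβ _
           (vanishesFrom-++ {L = 1} van (x≥1 ∷ []) (ℕP.+-identityʳ x) (s≤s z≤n))) ⟩
    pow a (x ∸ 1) * (leadingCoeff β * ψ (x ∷ β))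
      ≈⟨ *-assoc _ _ _ ⟨
    leadingCoeff (x ∷ β) * ψ (x ∷ β) ∎

  coeff-v : ∀ {λ′ μ} → IsPartition λ′ →
    (∀ w → Positive w → sum w ≡ sum λ′ → length λ′ < length w → shape w ≢ μ) →
    coeff (v λ′) μ ≈ (if does (λ′ ≟ₗ μ) then leadingCoeff λ′ else 0#)
  coeff-v {λ′} {μ} λ′-part@(pλ , _) avoids-μ = begin
    coeff (v λ′) μ
      ≈⟨ coeff≈eval-δ R (v λ′) μ ⟩
    eval R (v λ′) (δ R μ)
      ≈⟨ eval-v-top pλ (δ R μ) (λ w pw sw lw → if-no R (shape w ≟ₗ μ) (avoids-μ w pw sw lw)) ⟩
    leadingCoeff λ′ * δ R μ λ′
      ≡⟨ ≡.cong (λ κ → leadingCoeff λ′ * (if does (κ ≟ₗ μ) then 1# else 0#)) (shapeOf-id λ′-part) ⟩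
    leadingCoeff λ′ * (if does (λ′ ≟ₗ μ) then 1# else 0#)
      ≈⟨ *-if R (does (λ′ ≟ₗ μ)) _ 1# ⟩
    (if does (λ′ ≟ₗ μ) then leadingCoeff λ′ * 1# else 0#)
      ≈⟨ if-cong R (does (λ′ ≟ₗ μ)) (*-identityʳ _) ⟩
    (if does (λ′ ≟ₗ μ) then leadingCoeff λ′ else 0#) ∎

  coeff-v-shorter : ∀ {λ′ μ} → IsPartition λ′ → length μ ≤ length λ′ →
    coeff (v λ′) μ ≈ (if does (λ′ ≟ₗ μ) then leadingCoeff λ′ else 0#)
  coeff-v-shorter {λ′} λ′-part μ≤λ′ = coeff-v λ′-part λ w pw _ λ′<w w~μ →
    ℕP.<-irrefl ≡.refl (ℕP.<-≤-trans λ′<w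
      (≡.subst (_≤ length λ′) (≡.trans (≡.sym (≡.cong length w~μ)) (length-shapeOf pw)) μ≤λ′))

  excess : List ℕ → ℕ
  excess ν = sum ν ∸ length ν

  excess-< : ∀ {λ′ μ} → Positive μ → sum μ ≡ sum λ′ → length λ′ < length μ → excess μ < excess λ′
  excess-< {λ′} {μ} pμ sum≡ λ′<μ = ≡.subst (λ s → s ∸ length μ < excess λ′) (≡.sym sum≡)
    (ℕP.∸-monoʳ-< λ′<μ (≡.subst (length μ ≤_) sum≡ (length≤sum pμ)))

  coeff-v-excess : ∀ {λ′ μ} → IsPartition λ′ → excess λ′ ≤ excess μ →
    coeff (v λ′) μ ≈ (if does (λ′ ≟ₗ μ) then leadingCoeff λ′ else 0#)
  coeff-v-excess {λ′} λ′-part λ′≤μ = coeff-v λ′-part λ w pw sw λ′<w w~μ →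
    ℕP.<-irrefl ≡.refl (ℕP.≤-<-trans λ′≤μ (≡.subst (λ κ → excess κ < excess λ′) w~μ
      (excess-< {λ′} (proj₁ (shapeOf-partition w)) (≡.trans (sum-shapeOf pw) sw)
                (≡.subst (length λ′ <_) (≡.sym (length-shapeOf pw)) λ′<w))))

  module _ (a-invertible : RightInvertible 1# _*_ a) where

    leadingCoeff-invertible : ∀ β → RightInvertible 1# _*_ (leadingCoeff β)
    leadingCoeff-invertible []      = 1# , *-identityˡ 1#
    leadingCoeff-invertible (x ∷ β) =
      *-invertible R (pow-invertible R a-invertible (x ∸ 1)) (leadingCoeff-invertible β)

    -- The coefficient of h_t, ℓ(t) = k, in the combination only receives contributions from terms
    -- of length < k, whose coefficients vanish by induction, and from t itself, weighted by the
    -- invertible leadingCoeff t.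
    linIndep : LinIndep v
    linIndep cs parts unique lincomb≈0 =
      All.tabulate (λ {t} t∈cs → All.lookup (shorter-vanish (suc (length (proj₂ t)))) t∈cs (ℕP.n<1+n _))
      where
      shorter-vanish : ∀ k → All (λ t → length (proj₂ t) < k → proj₁ t ≈ 0#) cs
      shorter-vanish zero    = All.tabulate (λ _ ())
      shorter-vanish (suc k) = All.tabulate (λ {t} t∈cs t<1+k →
        [ All.lookup (shorter-vanish k) t∈cs , length-k t∈cs ]′ (ℕP.m<1+n⇒m<n∨m≡n t<1+k))
        where
        length-k : ∀ {t} → t ∈ cs → length (proj₂ t) ≡ k → proj₁ t ≈ 0#
        length-k {t} t∈cs t≡k = invertible-cancelʳ R (leadingCoeff-invertible (proj₂ t)) (begin
          proj₁ t * leadingCoeff (proj₂ t)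
            ≈⟨ sumOver-unique R _≟ₗ_ proj₂ cs (λ s → proj₁ s * leadingCoeff (proj₂ s)) unique t∈cs ⟨
          sumOver R cs (λ s → if does (proj₂ s ≟ₗ proj₂ t) then proj₁ s * leadingCoeff (proj₂ s) else 0#)
            ≈⟨ sumOver-congᴬ R cs (All.tabulate term) ⟨
          sumOver R cs (λ s → proj₁ s * coeff (v (proj₂ s)) (proj₂ t))
            ≈⟨ coeff-lincomb R v cs (proj₂ t) ⟨
          coeff (lincomb cs v) (proj₂ t)
            ≈⟨ lincomb≈0 (proj₂ t) ⟩
          0# ∎)
          where
          term : ∀ {s} → s ∈ cs → proj₁ s * coeff (v (proj₂ s)) (proj₂ t)
            ≈ (if does (proj₂ s ≟ₗ proj₂ t) then proj₁ s * leadingCoeff (proj₂ s) else 0#)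
          term {s} s∈cs with length (proj₂ s) ℕP.<? k
          ... | yes s<k = trans (annihilates _) (sym (if-zero R (does (proj₂ s ≟ₗ proj₂ t)) (annihilates _)))
            where
            annihilates : ∀ y → proj₁ s * y ≈ 0#
            annihilates y = trans (*-congʳ (All.lookup (shorter-vanish k) s∈cs s<k)) (zeroˡ y)
          ... | no  s≮k = trans (*-congˡ (coeff-v-shorter (All.lookup parts s∈cs)
                                   (≡.subst (_≤ length (proj₂ s)) (≡.sym t≡k) (ℕP.≮⇒≥ s≮k))))
                                (*-if R (does (proj₂ s ≟ₗ proj₂ t)) _ _)

    InSpan : Sym → Set (c ⊔ ℓ)
    InSpan f = ∃ λ cs → All (IsPartition ∘ proj₂) cs × f ≈S lincomb cs v

    InSpan-resp : ∀ {f g} → f ≈S g → InSpan g → InSpan f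
    InSpan-resp f≈g (cs , parts , g≈cs) = cs , parts , λ μ → trans (f≈g μ) (g≈cs μ)

    InSpan-[] : InSpan []
    InSpan-[] = [] , [] , λ _ → refl

    InSpan-++ : ∀ {f g} → InSpan f → InSpan g → InSpan (f ++ g)
    InSpan-++ {f} {g} (cs , pcs , f≈cs) (ds , pds , g≈ds) = cs ++ ds , AllP.++⁺ pcs pds , λ μ → begin
      coeff (f ++ g) μ
        ≈⟨ coeff-++ R f g μ ⟩
      coeff f μ + coeff g μ
        ≈⟨ +-cong (f≈cs μ) (g≈ds μ) ⟩
      coeff (lincomb cs v) μ + coeff (lincomb ds v) μ
        ≈⟨ coeff-++ R (lincomb cs v) (lincomb ds v) μ ⟨
      coeff (lincomb cs v ++ lincomb ds v) μ
        ≡⟨ ≡.cong (λ h → coeff h μ) (ListP.concatMap-++ _ cs ds) ⟨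
      coeff (lincomb (cs ++ ds) v) μ ∎

    InSpan-·S : ∀ x {f} → InSpan f → InSpan (x ·S f)
    InSpan-·S x {f} (cs , pcs , f≈cs) = List.map scale cs , AllP.map⁺ pcs , λ μ → begin
      coeff (x ·S f) μ
        ≈⟨ coeff-·S R x f μ ⟩
      x * coeff f μ
        ≈⟨ *-congˡ (trans (f≈cs μ) (coeff-lincomb R v cs μ)) ⟩
      x * sumOver R cs (λ t → proj₁ t * coeff (v (proj₂ t)) μ)
        ≈⟨ sumOver-*ˡ R cs x _ ⟨
      sumOver R cs (λ t → x * (proj₁ t * coeff (v (proj₂ t)) μ))
        ≈⟨ sumOver-cong R cs (λ t → *-assoc _ _ _) ⟨
      sumOver R cs (λ t → x * proj₁ t * coeff (v (proj₂ t)) μ)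
        ≡⟨ sumOver-map R scale cs _ ⟨
      sumOver R (List.map scale cs) (λ t → proj₁ t * coeff (v (proj₂ t)) μ)
        ≈⟨ coeff-lincomb R v (List.map scale cs) μ ⟨
      coeff (lincomb (List.map scale cs) v) μ ∎
      where
      scale : Carrier × List ℕ → Carrier × List ℕ
      scale (y , λ′) = x * y , λ′

    InSpan-v : ∀ {λ′} → IsPartition λ′ → InSpan (v λ′)
    InSpan-v {λ′} λ′-part = (1# , λ′) ∷ [] , λ′-part ∷ [] , λ μ → sym (begin
      coeff (1# ·S v λ′ ++ []) μ       ≈⟨ coeff-++ R (1# ·S v λ′) [] μ ⟩
      coeff (1# ·S v λ′) μ + 0#       ≈⟨ +-identityʳ _ ⟩
      coeff (1# ·S v λ′) μ            ≈⟨ coeff-·S R 1# (v λ′) μ ⟩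
      1# * coeff (v λ′) μ             ≈⟨ *-identityˡ _ ⟩
      coeff (v λ′) μ                  ∎)

    InSpan-monomial : ∀ x w → InSpan ((1# , shape w) ∷ []) → InSpan ((x , w) ∷ [])
    InSpan-monomial x w h = InSpan-resp {(x , w) ∷ []} {x ·S ((1# , shape w) ∷ [])} (λ μ → begin
      coeff ((x , w) ∷ []) μ
        ≈⟨ coeff-monomial R x w μ ⟩
      (if does (shape w ≟ₗ μ) then x else 0#)
        ≈⟨ if-cong R (does (shape w ≟ₗ μ)) (*-identityʳ x) ⟨
      (if does (shape w ≟ₗ μ) then x * 1# else 0#)
        ≡⟨ ≡.cong (λ κ → if does (κ ≟ₗ μ) then x * 1# else 0#) (shapeOf-id (shapeOf-partition w)) ⟨
      (if does (shape (shape w) ≟ₗ μ) then x * 1# else 0#)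
        ≈⟨ coeff-monomial R (x * 1#) (shape w) μ ⟨
      coeff (x ·S ((1# , shape w) ∷ [])) μ ∎)
      (InSpan-·S x {(1# , shape w) ∷ []} h)

    InSpan-all : ∀ f → All (λ t → InSpan ((1# , shape (proj₂ t)) ∷ [])) f → InSpan f
    InSpan-all []            []        = InSpan-[]
    InSpan-all ((x , w) ∷ f) (hw ∷ hf) = InSpan-++ {(x , w) ∷ []} {f} (InSpan-monomial x w hw) (InSpan-all f hf)

    -- h_λ = u (v λ − (terms of v λ of smaller excess)), with u the inverse of the leading coefficient:
    -- by triangularity the remaining terms of v λ are exactly (leadingCoeff λ) h_λ.
    InSpan-step : ∀ {λ′} → IsPartition λ′ →
      (∀ {ν} → IsPartition ν → excess ν < excess λ′ → InSpan ((1# , ν) ∷ [])) → InSpan ((1# , λ′) ∷ [])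
    InSpan-step {λ′} λ′-part ih =
      InSpan-resp {(1# , λ′) ∷ []} {u ·S combination} h≈ (InSpan-·S u {combination} combination-in-span)
      where
      u : Carrier
      u = proj₁ (leadingCoeff-invertible λ′)
      lower? : ∀ κ → Dec (excess κ < excess λ′)
      lower? κ = excess κ ℕP.<? excess λ′
      lower : Sym
      lower = List.filter (λ t → lower? (shape (proj₂ t))) (v λ′)
      combination : Sym
      combination = v λ′ ++ (- 1#) ·S lower

      combination-in-span : InSpan combination
      combination-in-span = InSpan-++ {v λ′} {(- 1#) ·S lower} (InSpan-v λ′-part) (InSpan-·S (- 1#) {lower}
        (InSpan-all lower (All.map (λ {t} → ih (shapeOf-partition (proj₂ t)))
                                   (AllP.all-filter (λ t → lower? (shape (proj₂ t))) (v λ′)))))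

      h≈ : (1# , λ′) ∷ [] ≈S u ·S combination
      h≈ μ = begin
        coeff ((1# , λ′) ∷ []) μ
          ≈⟨ coeff-monomial R 1# λ′ μ ⟩
        (if does (shape λ′ ≟ₗ μ) then 1# else 0#)
          ≡⟨ ≡.cong (λ κ → if does (κ ≟ₗ μ) then 1# else 0#) (shapeOf-id λ′-part) ⟩
        (if does (λ′ ≟ₗ μ) then 1# else 0#)
          ≈⟨ by-excess (lower? μ) ⟩
        u * (coeff (v λ′) μ + - 1# * (if does (lower? μ) then coeff (v λ′) μ else 0#))
          ≈⟨ *-congˡ (+-congˡ (*-congˡ (coeff-filter-shape R lower? (v λ′) μ))) ⟨
        u * (coeff (v λ′) μ + - 1# * coeff lower μ)
          ≈⟨ *-congˡ (+-congˡ (coeff-·S R (- 1#) lower μ)) ⟨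
        u * (coeff (v λ′) μ + coeff ((- 1#) ·S lower) μ)
          ≈⟨ *-congˡ (coeff-++ R (v λ′) _ μ) ⟨
        u * coeff (v λ′ ++ (- 1#) ·S lower) μ
          ≈⟨ coeff-·S R u (v λ′ ++ (- 1#) ·S lower) μ ⟨
        coeff (u ·S (v λ′ ++ (- 1#) ·S lower)) μ ∎
        where
        by-excess : (μ<λ′? : Dec (excess μ < excess λ′)) →
          (if does (λ′ ≟ₗ μ) then 1# else 0#)
          ≈ u * (coeff (v λ′) μ + - 1# * (if does μ<λ′? then coeff (v λ′) μ else 0#))
        by-excess (yes μ<λ′) = begin
          (if does (λ′ ≟ₗ μ) then 1# else 0#)
            ≈⟨ if-no R (λ′ ≟ₗ μ) (λ { ≡.refl → ℕP.<-irrefl ≡.refl μ<λ′ }) ⟩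
          0#
            ≈⟨ zeroʳ u ⟨
          u * 0#
            ≈⟨ *-congˡ (-‿inverseʳ _) ⟨
          u * (coeff (v λ′) μ + - coeff (v λ′) μ)
            ≈⟨ *-congˡ (+-congˡ (-1*x≈-x _)) ⟨
          u * (coeff (v λ′) μ + - 1# * coeff (v λ′) μ) ∎
        by-excess (no μ≮λ′) = begin
          (if does (λ′ ≟ₗ μ) then 1# else 0#)
            ≈⟨ if-cong R (does (λ′ ≟ₗ μ)) (trans (*-comm _ _) (proj₂ (leadingCoeff-invertible λ′))) ⟨
          (if does (λ′ ≟ₗ μ) then u * leadingCoeff λ′ else 0#)
            ≈⟨ *-if R (does (λ′ ≟ₗ μ)) u _ ⟨
          u * (if does (λ′ ≟ₗ μ) then leadingCoeff λ′ else 0#)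
            ≈⟨ *-congˡ (coeff-v-excess λ′-part (ℕP.≮⇒≥ μ≮λ′)) ⟨
          u * coeff (v λ′) μ
            ≈⟨ *-congˡ (trans (+-congˡ (zeroʳ _)) (+-identityʳ _)) ⟨
          u * (coeff (v λ′) μ + - 1# * 0#) ∎

    InSpan-partition : ∀ λ′ → IsPartition λ′ → InSpan ((1# , λ′) ∷ [])
    InSpan-partition = WF.All.wfRec (On.wellFounded excess ℕInd.<-wellFounded) (c ⊔ ℓ)
      (λ λ′ → IsPartition λ′ → InSpan ((1# , λ′) ∷ []))
      (λ λ′ rec λ′-part → InSpan-step λ′-part (λ ν-part ν<λ′ → rec ν<λ′ ν-part))

    spans : Spans v
    spans f = InSpan-all f
      (All.tabulate (λ {t} _ → InSpan-partition (shape (proj₂ t)) (shapeOf-partition (proj₂ t))))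

proposition4p13 : ∀ {c ℓ} (R : CommutativeRing c ℓ) → IsField R
    → (a b : CommutativeRing.Carrier R)
    → ¬ (CommutativeRing._≈_ R a (CommutativeRing.0# R))
    → WithRing.IsBasis R (λ λ′ → WithRing.comm R (WithRing.𝓑̂ R a b λ′))
      × WithRing.Multiplicative R (λ λ′ → WithRing.comm R (WithRing.𝓑̂ R a b λ′))
proposition4p13 R (_ , inverse) a b a≉0 =
  (linIndep R a b (inverse a a≉0) , spans R a b (inverse a a≉0)) , multiplicative R a b
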